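{- Let $T\in[0..\sigma)^n$ with $n\ge 1$, and let $T'=\big(\bigodot_{i=1}^{n}(T[i]+1)\big)\cdot 0\in[0..\sigma+1)^{n+1}$. Then $r(T')\le r(T)+3$.
   Context: Strings over integers with the usual order; lexicographic order: a proper prefix is smaller, otherwise compare at the first differing position. For a string $S$ of length $N$, $\mathrm{SA}_S$ lists the starting positions of its suffixes in increasing lexicographic order; $\mathrm{BWT}_S[i]=S[\mathrm{SA}_S[i]-1]$ if $\mathrm{SA}_S[i]>1$ and $S[N]$ otherwise; $r(S)$ is the number of maximal equal-letter runs in $\mathrm{BWT}_S[1..N]$. -}

module Defs where

open import Data.Nat using (ℕ; zero; suc; _+_; _∸_; _<ᵇ_; _≡ᵇ_)
open import Data.Bool using (Bool; true; false; if_then_else_; _∨_; _∧_)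
open import Data.List using (List; []; _∷_; length; map; drop; upTo)

-- Strings are lists of naturals; positions are 0-based here
-- (position i here = position i+1 in the paper).

lexLt : List ℕ → List ℕ → Bool
lexLt []       []       = false
lexLt []       (_ ∷ _)  = true
lexLt (_ ∷ _)  []       = false
lexLt (x ∷ xs) (y ∷ ys) = (x <ᵇ y) ∨ ((x ≡ᵇ y) ∧ lexLt xs ys)

suffix : List ℕ → ℕ → List ℕ
suffix S i = drop i S

insertSuf : List ℕ → ℕ → List ℕ → List ℕ
insertSuf S i []       = i ∷ []
insertSuf S i (j ∷ js) =
  if lexLt (suffix S i) (suffix S j) then i ∷ j ∷ js else j ∷ insertSuf S i js

sortSuf : List ℕ → List ℕ → List ℕ
sortSuf S []       = []
sortSuf S (i ∷ is) = insertSuf S i (sortSuf S is)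

-- Suffix array (0-based starting positions of suffixes in increasing
-- lexicographic order).  Distinct suffixes have distinct lengths, so the
-- order is strict total and the sorted list is unique.
SA : List ℕ → List ℕ
SA S = sortSuf S (upTo (length S))

-- S[k] (0-based), default 0 outside range (never used out of range)
at : List ℕ → ℕ → ℕ
at []       _       = 0
at (x ∷ _)  zero    = x
at (_ ∷ xs) (suc k) = at xs k

-- BWT[i] = S[SA[i]-1] if SA[i] is not the first position, else S[N]
bwtChar : List ℕ → ℕ → ℕ
bwtChar S zero    = at S (length S ∸ 1)
bwtChar S (suc k) = at S k

BWT : List ℕ → List ℕ
BWT S = map (bwtChar S) (SA S)

runs : List ℕ → ℕ
runs []           = 0
runs (_ ∷ [])     = 1
runs (x ∷ y ∷ xs) = (if x ≡ᵇ y then 0 else 1) + runs (y ∷ xs)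

r : List ℕ → ℕ
r S = runs (BWT S)

{-# OPTIONS --safe #-}
-- Appending the sentinel 0 to the shifted text T + 1 creates one new suffix, the
-- smallest, and keeps the relative order of all other suffixes: shifting is an
-- order embedding, and the sentinel takes over the role of the end of the string.
-- So SA(T') = n ∷ SA(T), and BWT(T') is a new first letter followed by BWT(T)
-- shifted by one, except at the position where SA(T) holds 0: there BWT(T) has
-- the last letter of T and BWT(T') the sentinel.  Shifting preserves runs, the
-- new first letter adds at most one run and the changed letter at most two.
module Submission where

open import Defs
open import Data.Nat using (ℕ; zero; suc; _+_; _≤_; _<_; _≡ᵇ_; z≤n; s≤s)
open import Data.Nat.Properties
open import Data.Bool using (true; false; if_then_else_)
open import Data.Product using (∃₂; _,_; _×_)
open import Data.List using (List; []; _∷_; _++_; _∷ʳ_; map; length; drop; upTo)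
open import Data.List.Properties using (map-++; map-∘; map-cong; map-cong-local; upTo-∷ʳ; drop-all)
open import Data.List.Relation.Unary.All as All using (All; []; _∷_)
open import Data.List.Relation.Unary.All.Properties using (all-upTo; applyUpTo⁺₁; ++⁻)
open import Data.List.Relation.Unary.Any using (here)
open import Data.List.Membership.Propositional.Properties using (∈-∃++)
open import Data.List.Relation.Binary.Permutation.Propositional
  using (_↭_; ↭-refl; ↭-prep; ↭-swap; ↭-sym; ↭-trans)
open import Data.List.Relation.Binary.Permutation.Propositional.Properties
  using (All-resp-↭; ∈-resp-↭; shift; drop-∷)
open import Function using (_∘_)
open import Relation.Binary.PropositionalEquality

↭-∷-split : ∀ {x : ℕ} {xs ys} → xs ↭ x ∷ ys →
  ∃₂ λ as bs → xs ≡ as ++ x ∷ bs × as ++ bs ↭ ys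
↭-∷-split {x} p with as , bs , refl ← ∈-∃++ (∈-resp-↭ (↭-sym p) (here refl)) =
  as , bs , refl , drop-∷ (↭-trans (↭-sym (shift x as bs)) p)

insertSuf-↭ : ∀ S i js → insertSuf S i js ↭ i ∷ js
insertSuf-↭ S i []       = ↭-refl
insertSuf-↭ S i (j ∷ js) with lexLt (suffix S i) (suffix S j)
... | true  = ↭-refl
... | false = ↭-trans (↭-prep j (insertSuf-↭ S i js)) (↭-swap j i ↭-refl)

sortSuf-↭ : ∀ S is → sortSuf S is ↭ is
sortSuf-↭ S []       = ↭-refl
sortSuf-↭ S (i ∷ is) = ↭-trans (insertSuf-↭ S i (sortSuf S is)) (↭-prep i (sortSuf-↭ S is))

SA-↭-upTo : ∀ S → SA S ↭ upTo (length S)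
SA-↭-upTo S = sortSuf-↭ S (upTo (length S))

SuffixOrderAgree : (ℕ → Set) → List ℕ → List ℕ → Set
SuffixOrderAgree P S S′ =
  ∀ {i j} → P i → P j → lexLt (suffix S i) (suffix S j) ≡ lexLt (suffix S′ i) (suffix S′ j)

module _ {P : ℕ → Set} {S S′ : List ℕ} (agree : SuffixOrderAgree P S S′) where

  insertSuf-cong : ∀ {i} js → P i → All P js → insertSuf S i js ≡ insertSuf S′ i js
  insertSuf-cong []       _  []           = refl
  insertSuf-cong {i} (j ∷ js) pi (pj ∷ pjs) rewrite agree pi pj
    with lexLt (suffix S′ i) (suffix S′ j)
  ... | true  = refl
  ... | false = cong (j ∷_) (insertSuf-cong js pi pjs)

  sortSuf-cong : ∀ is → All P is → sortSuf S is ≡ sortSuf S′ is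
  sortSuf-cong []       []         = refl
  sortSuf-cong (i ∷ is) (pi ∷ pis) =
    trans (cong (insertSuf S i) (sortSuf-cong is pis))
          (insertSuf-cong (sortSuf S′ is) pi (All-resp-↭ (↭-sym (sortSuf-↭ S′ is)) pis))

sortSuf-∷ʳ-minimum : ∀ S m is → All (λ i → lexLt (suffix S i) (suffix S m) ≡ false) is →
  sortSuf S (is ∷ʳ m) ≡ m ∷ sortSuf S is
sortSuf-∷ʳ-minimum S m []       []       = refl
sortSuf-∷ʳ-minimum S m (i ∷ is) (i≮m ∷ is≮m)
  rewrite sortSuf-∷ʳ-minimum S m is is≮m | i≮m = refl

lexLt-[] : ∀ xs → lexLt xs [] ≡ false
lexLt-[] []      = refl
lexLt-[] (_ ∷ _) = refl

terminate : List ℕ → List ℕ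
terminate T = map suc T ++ 0 ∷ []

length-terminate : ∀ T → length (terminate T) ≡ suc (length T)
length-terminate []      = refl
length-terminate (_ ∷ T) = cong suc (length-terminate T)

drop-terminate : ∀ T i → i ≤ length T → drop i (terminate T) ≡ terminate (drop i T)
drop-terminate T       zero    _         = refl
drop-terminate (_ ∷ T) (suc i) (s≤s i≤n) = drop-terminate T i i≤n

lexLt-terminate : ∀ xs ys → lexLt (terminate xs) (terminate ys) ≡ lexLt xs ys
lexLt-terminate []       []       = refl
lexLt-terminate []       (_ ∷ _)  = refl
lexLt-terminate (_ ∷ _)  []       = refl
lexLt-terminate (x ∷ xs) (y ∷ ys) rewrite lexLt-terminate xs ys = refl

suffixOrder-terminate : ∀ T → SuffixOrderAgree (_≤ length T) (terminate T) T
suffixOrder-terminate T {i} {j} i≤n j≤n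
  rewrite drop-terminate T i i≤n | drop-terminate T j j≤n = lexLt-terminate (drop i T) (drop j T)

terminate-last-minimum : ∀ T i → i ≤ length T →
  lexLt (suffix (terminate T) i) (suffix (terminate T) (length T)) ≡ false
terminate-last-minimum T i i≤n
  rewrite suffixOrder-terminate T i≤n ≤-refl | drop-all (length T) T ≤-refl = lexLt-[] (drop i T)

SA-terminate : ∀ T → SA (terminate T) ≡ length T ∷ SA T
SA-terminate T = begin
  SA E                      ≡⟨ cong (sortSuf E ∘ upTo) (length-terminate T) ⟩
  sortSuf E (upTo (suc n))  ≡⟨ cong (sortSuf E) (upTo-∷ʳ n) ⟨
  sortSuf E (upTo n ∷ʳ n)   ≡⟨ sortSuf-∷ʳ-minimum E n (upTo n)
                                 (All.map (terminate-last-minimum T _) positions) ⟩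
  n ∷ sortSuf E (upTo n)    ≡⟨ cong (n ∷_) (sortSuf-cong (suffixOrder-terminate T) (upTo n) positions) ⟩
  n ∷ SA T                  ∎
  where
  open ≡-Reasoning
  E : List ℕ
  E = terminate T
  n : ℕ
  n = length T
  positions : All (_≤ n) (upTo n)
  positions = All.map <⇒≤ (all-upTo n)

at-terminate : ∀ T k → k < length T → at (terminate T) k ≡ suc (at T k)
at-terminate (_ ∷ _) zero    _         = refl
at-terminate (_ ∷ T) (suc k) (s≤s k<n) = at-terminate T k k<n

boundary : ℕ → ℕ → ℕ
boundary x y = if x ≡ᵇ y then 0 else 1

boundary≤1 : ∀ x y → boundary x y ≤ 1
boundary≤1 x y with x ≡ᵇ y
... | true  = z≤n
... | false = ≤-refl

runs-∷-≤ : ∀ x xs → runs (x ∷ xs) ≤ suc (runs xs)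
runs-∷-≤ x []       = ≤-refl
runs-∷-≤ x (y ∷ xs) = +-monoˡ-≤ (runs (y ∷ xs)) (boundary≤1 x y)

runs-≤-∷ : ∀ x xs → runs xs ≤ runs (x ∷ xs)
runs-≤-∷ x []       = z≤n
runs-≤-∷ x (y ∷ xs) = m≤n+m (runs (y ∷ xs)) (boundary x y)

runs-change-head : ∀ x y ys → runs (x ∷ ys) ≤ suc (runs (y ∷ ys))
runs-change-head x y ys = ≤-trans (runs-∷-≤ x ys) (s≤s (runs-≤-∷ y ys))

runs-change-letter : ∀ xs x y ys → runs (xs ++ x ∷ ys) ≤ runs (xs ++ y ∷ ys) + 2
runs-change-letter [] x y ys = begin
  runs (x ∷ ys)           ≤⟨ runs-change-head x y ys ⟩
  suc (runs (y ∷ ys))     ≤⟨ n≤1+n _ ⟩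
  2 + runs (y ∷ ys)       ≡⟨ +-comm 2 _ ⟩
  runs (y ∷ ys) + 2       ∎
  where open ≤-Reasoning
runs-change-letter (a ∷ []) x y ys = begin
  boundary a x + runs (x ∷ ys)       ≤⟨ +-mono-≤ (boundary≤1 a x) (runs-change-head x y ys) ⟩
  2 + runs (y ∷ ys)                  ≤⟨ +-monoʳ-≤ 2 (m≤n+m _ (boundary a y)) ⟩
  2 + runs (a ∷ y ∷ ys)              ≡⟨ +-comm 2 _ ⟩
  runs (a ∷ y ∷ ys) + 2              ∎
  where open ≤-Reasoning
runs-change-letter (a ∷ b ∷ xs) x y ys = begin
  boundary a b + runs (b ∷ xs ++ x ∷ ys)
    ≤⟨ +-monoʳ-≤ (boundary a b) (runs-change-letter (b ∷ xs) x y ys) ⟩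
  boundary a b + (runs (b ∷ xs ++ y ∷ ys) + 2)
    ≡⟨ +-assoc (boundary a b) _ 2 ⟨
  runs (a ∷ b ∷ xs ++ y ∷ ys) + 2
    ∎
  where open ≤-Reasoning

runs-map-suc : ∀ xs → runs (map suc xs) ≡ runs xs
runs-map-suc []           = refl
runs-map-suc (_ ∷ [])     = refl
runs-map-suc (x ∷ y ∷ xs) = cong (boundary x y +_) (runs-map-suc (y ∷ xs))

runs-map-suc-except : ∀ (f g : ℕ → ℕ) as i bs → All (λ j → f j ≡ suc (g j)) (as ++ bs) →
  runs (map f (as ++ i ∷ bs)) ≤ runs (map g (as ++ i ∷ bs)) + 2
runs-map-suc-except f g as i bs shifted = begin
  runs (map f (as ++ i ∷ bs))                ≡⟨ cong runs split-f ⟩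
  runs (us ++ f i ∷ vs)                      ≤⟨ runs-change-letter us (f i) (suc (g i)) vs ⟩
  runs (us ++ suc (g i) ∷ vs) + 2            ≡⟨ cong (λ ws → runs ws + 2) split-g ⟨
  runs (map suc (map g (as ++ i ∷ bs))) + 2  ≡⟨ cong (_+ 2) (runs-map-suc (map g (as ++ i ∷ bs))) ⟩
  runs (map g (as ++ i ∷ bs)) + 2            ∎
  where
  open ≤-Reasoning
  us vs : List ℕ
  us = map suc (map g as)
  vs = map suc (map g bs)
  split-f : map f (as ++ i ∷ bs) ≡ us ++ f i ∷ vs
  split-f with shiftedˡ , shiftedʳ ← ++⁻ as shifted =
    trans (map-++ f as (i ∷ bs))
          (cong₂ (λ ws zs → ws ++ f i ∷ zs) (trans (map-cong-local shiftedˡ) (map-∘ as))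
                                            (trans (map-cong-local shiftedʳ) (map-∘ bs)))
  split-g : map suc (map g (as ++ i ∷ bs)) ≡ us ++ suc (g i) ∷ vs
  split-g = trans (cong (map suc) (map-++ g as (i ∷ bs))) (map-++ suc (map g as) (g i ∷ map g bs))

r-terminate : ∀ T → 1 ≤ length T → r (terminate T) ≤ r T + 3
r-terminate [] ()
r-terminate T@(_ ∷ T′) _ with as , bs , SA≡ , as++bs↭ ← ↭-∷-split (SA-↭-upTo T) = begin
  r (terminate T)                        ≡⟨ cong (runs ∘ map f) (SA-terminate T) ⟩
  runs (f (length T) ∷ map f (SA T))     ≤⟨ runs-∷-≤ (f (length T)) (map f (SA T)) ⟩
  suc (runs (map f (SA T)))              ≡⟨ cong (suc ∘ runs ∘ map f) SA≡ ⟩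
  suc (runs (map f (as ++ 0 ∷ bs)))      ≤⟨ s≤s (runs-map-suc-except f g as 0 bs shifted) ⟩
  suc (runs (map g (as ++ 0 ∷ bs)) + 2)  ≡⟨ cong (λ is → suc (runs (map g is) + 2)) SA≡ ⟨
  suc (r T + 2)                          ≡⟨ +-suc (r T) 2 ⟨
  r T + 3                                ∎
  where
  open ≤-Reasoning
  f g : ℕ → ℕ
  f = bwtChar (terminate T)
  g = bwtChar T
  shifted : All (λ j → f j ≡ suc (g j)) (as ++ bs)
  shifted = All-resp-↭ (↭-sym as++bs↭)
    (applyUpTo⁺₁ suc (length T′) (λ k<n → at-terminate T _ (m<n⇒m<1+n k<n)))

mainTheorem8 : (σ : ℕ) (T : List ℕ) → 1 ≤ length T → All (_< σ) T →
    r (map (λ c → c + 1) T ++ (0 ∷ [])) ≤ r T + 3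
mainTheorem8 σ T 1≤n _ =
  subst (λ T′ → r (T′ ++ 0 ∷ []) ≤ r T + 3) (map-cong (λ c → +-comm 1 c) T) (r-terminate T 1≤n)
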